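{- Let $\mathcal{F}$ be a set of natural number functions satisfying the standard conditions, let $A:\mathbb{N}\to\mathbb{Q}$ be an $\mathcal{F}$-sequence and let $\alpha$ be a real number. If the function $x\mapsto x\,|A(x)-\alpha|$ is bounded on $\mathbb{N}$, then $\alpha\in\mathbb{R}_{\mathcal{F}}$.
   Context: $\mathbb{N}=\{0,1,2,\dots\}$. A natural number function is a map $\mathbb{N}^n\to\mathbb{N}$. A set $\mathcal{F}$ of natural number functions satisfies the standard conditions if it contains the zero function $Z(x)=0$, the successor $S(x)=x+1$, all projections $P^n_i(x_1,\dots,x_n)=x_i$, addition, multiplication and modified subtraction $x\dot- y=\max(x-y,0)$, and is closed under composition. An $\mathcal{F}$-sequence is a function $A:\mathbb{N}\to\mathbb{Q}$ of the form $A(x)=\frac{f(x)-g(x)}{h(x)+1}$ with $f,g,h:\mathbb{N}\to\mathbb{N}$ in $\mathcal{F}$. A real number $\alpha$ is $\mathcal{F}$-computable if there is an $\mathcal{F}$-sequence $A$ with $|A(x)-\alpha|\le\frac{1}{x+1}$ for all $x\in\mathbb{N}$; $\mathbb{R}_{\mathcal{F}}$ is the set of $\mathcal{F}$-computable reals. -}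

module Defs where

open import Data.Nat as ℕ using (ℕ; suc; _+_; _*_; _∸_)
open import Data.Fin using (Fin)
import Data.Fin as Fin
open import Data.Vec using (Vec; lookup; head; map)
open import Data.Integer using (+_)
import Data.Integer as ℤ
open import Data.Rational as ℚ using (ℚ; _/_; ∣_∣)
open import Data.Product using (Σ; ∃; _×_)
open import Relation.Binary.PropositionalEquality using (_≡_)

NatFun : ℕ → Set
NatFun n = Vec ℕ n → ℕ

FunSet : Set₁
FunSet = (n : ℕ) → NatFun n → Set

_∈₁_ : (ℕ → ℕ) → FunSet → Set
f ∈₁ 𝓕 = 𝓕 1 (λ v → f (head v))

record Standard (𝓕 : FunSet) : Set where
  field
    zeroF : 𝓕 1 (λ _ → 0)
    succF : 𝓕 1 (λ v → suc (head v))
    projF : (n : ℕ) (i : Fin n) → 𝓕 n (λ v → lookup v i)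
    addF  : 𝓕 2 (λ v → lookup v Fin.zero + lookup v (Fin.suc Fin.zero))
    mulF  : 𝓕 2 (λ v → lookup v Fin.zero * lookup v (Fin.suc Fin.zero))
    monusF : 𝓕 2 (λ v → lookup v Fin.zero ∸ lookup v (Fin.suc Fin.zero))
    compF : (m n : ℕ) (f : NatFun m) (gs : Vec (NatFun n) m) →
            𝓕 m f → ((i : Fin m) → 𝓕 n (lookup gs i)) →
            𝓕 n (λ x → f (map (λ g → g x) gs))

IsFSeq : FunSet → (ℕ → ℚ) → Set
IsFSeq 𝓕 A = Σ (ℕ → ℕ) λ f → Σ (ℕ → ℕ) λ g → Σ (ℕ → ℕ) λ h →
  (f ∈₁ 𝓕) × (g ∈₁ 𝓕) × (h ∈₁ 𝓕) ×
  ((x : ℕ) → A x ≡ (+ f x ℤ.- + g x) / suc (h x))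

-- Real numbers (Bishop): regular Cauchy sequences of rationals,
-- |α_m - α_n| ≤ 1/(m+1) + 1/(n+1)
record ℝ : Set where
  field
    seq : ℕ → ℚ
    reg : (m n : ℕ) → ∣ seq m ℚ.- seq n ∣ ℚ.≤ (+ 1 / suc m) ℚ.+ (+ 1 / suc n)
open ℝ public

-- the real inequality  t · |q - α| ≤ M  (t, q, M rational, α real),
-- via Bishop's order: x ≤ y iff ∀ n. x_n ≤ y_n + (error 2/(n+1), scaled by t)
ScaledDistLe : ℚ → ℚ → ℝ → ℚ → Set
ScaledDistLe t q α M =
  (n : ℕ) → t ℚ.* ∣ q ℚ.- seq α n ∣ ℚ.≤ M ℚ.+ t ℚ.* (+ 2 / suc n)

DistLe : ℚ → ℝ → ℚ → Set
DistLe q α ε = ScaledDistLe ℚ.1ℚ q α ε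

FComputable : FunSet → ℝ → Set
FComputable 𝓕 α = Σ (ℕ → ℚ) λ B → IsFSeq 𝓕 B × ((x : ℕ) → DistLe (B x) α (+ 1 / suc x))

BoundedScaledDist : (ℕ → ℚ) → ℝ → Set
BoundedScaledDist A α = Σ ℚ λ M → (x : ℕ) → ScaledDistLe (+ x / 1) (A x) α M

-- Subsampling A along x ↦ K(x+1) for an integer K ≥ max(M, 1), where M bounds x |A(x) − α|,
-- gives K(x+1) |A(K(x+1)) − α| ≤ M ≤ K, i.e. |A(K(x+1)) − α| ≤ 1/(x+1).  The subsampled
-- sequence is again an 𝓕-sequence, since x ↦ K(x+1) is built from constants, successor and
-- multiplication, and 𝓕 is closed under composition.
module Submission where

open import Defs
open import Data.Nat using (ℕ)
open import Data.Rational using (ℚ)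

open import Data.Nat as ℕ using (suc; zero)
import Data.Nat.Properties as ℕP
open import Data.Integer as ℤ using (ℤ; +_; -[1+_])
import Data.Integer.Properties as ℤP
open import Data.Rational as ℚ using (mkℚ; _/_; toℚᵘ; Positive)
import Data.Rational.Properties as ℚP
open import Data.Rational.Unnormalised as ℚᵘ using (mkℚᵘ; *≡*; *≤*)
import Data.Rational.Unnormalised.Properties as ℚᵘP
open import Data.Vec using (_∷_; []; head)
import Data.Fin as Fin
open import Data.Product using (_,_)
open import Function using (_∘_)
open import Relation.Binary.PropositionalEquality using (_≡_; sym; trans; cong)

toℚᵘ-/ : ∀ (i : ℤ) (n : ℕ) → toℚᵘ (i / suc n) ℚᵘ.≃ mkℚᵘ i n
toℚᵘ-/ i n = ℚP.toℚᵘ-fromℚᵘ (mkℚᵘ i n)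

p≤1+∣↥p∣ : ∀ p → p ℚ.≤ + suc ℤ.∣ ℚ.↥ p ∣ / 1
p≤1+∣↥p∣ p = ℚP.toℚᵘ-cancel-≤ (ℚᵘP.≤-respʳ-≃ (ℚᵘP.≃-sym (toℚᵘ-/ _ 0)) (numerator-bound p))
  where
  numerator-bound : ∀ p → toℚᵘ p ℚᵘ.≤ mkℚᵘ (+ suc ℤ.∣ ℚ.↥ p ∣) 0
  numerator-bound (mkℚ (+ n) d _) =
    *≤* (ℤP.≤-trans (ℤP.≤-reflexive (ℤP.*-identityʳ (+ n)))
                    (ℤ.+≤+ (ℕP.≤-trans (ℕP.n≤1+n n) (ℕP.m≤m*n (suc n) (suc d)))))
  numerator-bound (mkℚ -[1+ n ] d _) = *≤* ℤ.-≤+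

*-/suc-cancel : ∀ m n → (+ (m ℕ.* suc n) / 1) ℚ.* (+ 1 / suc n) ≡ + m / 1
*-/suc-cancel m n = ℚP.toℚᵘ-injective (begin
  toℚᵘ (+ (m ℕ.* suc n) / 1 ℚ.* (+ 1 / suc n))
    ≈⟨ ℚP.toℚᵘ-homo-* (+ (m ℕ.* suc n) / 1) (+ 1 / suc n) ⟩
  toℚᵘ (+ (m ℕ.* suc n) / 1) ℚᵘ.* toℚᵘ (+ 1 / suc n)
    ≈⟨ ℚᵘP.*-cong (toℚᵘ-/ (+ (m ℕ.* suc n)) 0) (toℚᵘ-/ (+ 1) n) ⟩
  mkℚᵘ (+ (m ℕ.* suc n)) 0 ℚᵘ.* mkℚᵘ (+ 1) n
    ≈⟨ *≡* (trans (ℤP.*-identityʳ _) (trans (ℤP.*-identityʳ _)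
             (trans (cong (λ k → + (m ℕ.* suc k)) (sym (ℕP.+-identityʳ n))) (ℤP.pos-* m _)))) ⟩
  mkℚᵘ (+ m) 0
    ≈⟨ toℚᵘ-/ (+ m) 0 ⟨
  toℚᵘ (+ m / 1) ∎)
  where open ℚᵘP.≃-Reasoning

ScaledDistLe-cancel : ∀ {t q α M ε} .{{_ : Positive t}} →
                      M ℚ.≤ t ℚ.* ε → ScaledDistLe t q α M → DistLe q α ε
ScaledDistLe-cancel {t} {q} {α} {M} {ε} M≤tε t∣q-α∣≤M n = begin
  ℚ.1ℚ ℚ.* ∣q-αₙ∣        ≡⟨ ℚP.*-identityˡ ∣q-αₙ∣ ⟩
  ∣q-αₙ∣                 ≤⟨ ℚP.*-cancelˡ-≤-pos t t∣q-αₙ∣≤t[ε+err] ⟩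
  ε ℚ.+ err              ≡⟨ cong (ε ℚ.+_) (ℚP.*-identityˡ err) ⟨
  ε ℚ.+ ℚ.1ℚ ℚ.* err     ∎
  where
  open ℚP.≤-Reasoning
  ∣q-αₙ∣ = ℚ.∣ q ℚ.- seq α n ∣
  err = + 2 / suc n
  t∣q-αₙ∣≤t[ε+err] : t ℚ.* ∣q-αₙ∣ ℚ.≤ t ℚ.* (ε ℚ.+ err)
  t∣q-αₙ∣≤t[ε+err] = begin
    t ℚ.* ∣q-αₙ∣           ≤⟨ t∣q-α∣≤M n ⟩
    M ℚ.+ t ℚ.* err        ≤⟨ ℚP.+-monoˡ-≤ (t ℚ.* err) M≤tε ⟩
    t ℚ.* ε ℚ.+ t ℚ.* err  ≡⟨ ℚP.*-distribˡ-+ t ε err ⟨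
    t ℚ.* (ε ℚ.+ err)      ∎

module _ {𝓕 : FunSet} (𝓕-standard : Standard 𝓕) where
  open Standard 𝓕-standard

  ∘-closed : ∀ {f g} → f ∈₁ 𝓕 → g ∈₁ 𝓕 → (f ∘ g) ∈₁ 𝓕
  ∘-closed {g = g} f∈𝓕 g∈𝓕 = compF 1 1 _ ((λ v → g (head v)) ∷ []) f∈𝓕 λ { Fin.zero → g∈𝓕 }

  const-closed : ∀ k → (λ _ → k) ∈₁ 𝓕
  const-closed zero    = zeroF
  const-closed (suc k) = ∘-closed {suc} {λ _ → k} succF (const-closed k)

  *-closed : ∀ {f g} → f ∈₁ 𝓕 → g ∈₁ 𝓕 → (λ x → f x ℕ.* g x) ∈₁ 𝓕
  *-closed {f} {g} f∈𝓕 g∈𝓕 =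
    compF 2 1 _ ((λ v → f (head v)) ∷ (λ v → g (head v)) ∷ []) mulF
      λ { Fin.zero → f∈𝓕 ; (Fin.suc Fin.zero) → g∈𝓕 }

  IsFSeq-∘ : ∀ {A φ} → IsFSeq 𝓕 A → φ ∈₁ 𝓕 → IsFSeq 𝓕 (A ∘ φ)
  IsFSeq-∘ {φ = φ} (f , g , h , f∈𝓕 , g∈𝓕 , h∈𝓕 , A≡) φ∈𝓕 =
    f ∘ φ , g ∘ φ , h ∘ φ ,
    ∘-closed {f} {φ} f∈𝓕 φ∈𝓕 , ∘-closed {g} {φ} g∈𝓕 φ∈𝓕 , ∘-closed {h} {φ} h∈𝓕 φ∈𝓕 ,
    A≡ ∘ φ

mainTheorem10 : (𝓕 : FunSet) → Standard 𝓕 → (A : ℕ → ℚ) → IsFSeq 𝓕 A →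
    (α : ℝ) → BoundedScaledDist A α → FComputable 𝓕 α
mainTheorem10 𝓕 𝓕-standard A A-seq α (M , x∣Aₓ-α∣≤M) =
  A ∘ φ , IsFSeq-∘ 𝓕-standard A-seq φ∈𝓕 , λ x →
    ScaledDistLe-cancel {t = + φ x / 1} {A (φ x)} {α} {ε = + 1 / suc x}
                        {{ℚP.normalize-pos (φ x) 1}}
      (ℚP.≤-trans (p≤1+∣↥p∣ M) (ℚP.≤-reflexive (sym (*-/suc-cancel K x))))
      (x∣Aₓ-α∣≤M (φ x))
  where
  K : ℕ
  K = suc ℤ.∣ ℚ.↥ M ∣
  φ : ℕ → ℕ
  φ x = K ℕ.* suc x
  φ∈𝓕 : φ ∈₁ 𝓕
  φ∈𝓕 = *-closed 𝓕-standard {λ _ → K} {suc}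
          (const-closed 𝓕-standard K) (Standard.succF 𝓕-standard)
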